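{- Let $D$ be a finite reflexive bidirectionally disconnected improper digraph with no back-and-forth. Then $D$ is homomorphism-homogeneous if and only if (1) $D$ is a finite homomorphism-homogeneous quasiorder, or (2) $D$ is an inflation of $k\cdot C_3^\circ+l\cdot\mathbf{1}^\circ$ for some $k,l\ge0$ with $k+l\ge1$.
   Context: A digraph $D=(V,E)$, $V$ finite, $E\subseteq V^2$; $x\to y$ means $(x,y)\in E$, $x\sim y$ means $x\to y$ or $y\to x$, $x\rightleftarrows y$ means both. Reflexive: all loops present; improper: $E$ neither symmetric nor antisymmetric. For nonempty $X,Y\subseteq V$: $X\to Y$ means $x\to y$ for some $x\in X,y\in Y$; $X\rightleftarrows Y$ means $X\to Y$ and $Y\to X$. Homomorphism: vertex map with $x\to y\Rightarrow f(x)\to f(y)$; $D[W]$ induced subdigraph; $D$ is homomorphism-homogeneous if every homomorphism $D[U]\to D[W]$ ($U,W$ nonempty) extends to an endomorphism. A quasiorder is a digraph whose relation is reflexive and transitive. $\omega(D)$ = number of weak connected components. $\theta(D)$: $(x,y)\in\theta(D)$ iff $x=y$ or $x=z_1\rightleftarrows\cdots\rightleftarrows z_k=y$ for some $z_i$. $D$ is bidirectionally disconnected if $\omega(D)<|V/\theta(D)|$. $D$ has no back-and-forth if for all $S,T\in V/\theta(D)$, $S\rightleftarrows T$ implies $S=T$. $\mathbf{1}^\circ$: one vertex with loop; $C_3^\circ$: vertices $1,2,3$, edges $1\to2\to3\to1$ and loops. $k\cdot D$: disjoint union of $k$ copies, $0\cdot D$ empty. Inflation of a digraph $R$ on $v_1,\dots,v_n$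 by finite nonempty pairwise disjoint sets $V_1,\dots,V_n$: vertex set $\bigcup V_i$, $x\to y$ for all $x,y$ in a common $V_i$, $x\to y$ for all $x\in V_i,y\in V_j$ when $i\ne j$ and $v_i\to v_j$ in $R$, no other edges. -}

module Defs where

open import Data.Nat using (ℕ; _<_)
open import Data.Fin using (Fin; zero; suc)
open import Data.Fin.Subset using (Subset; _∈_; Nonempty)
open import Data.Bool using (Bool; true; false)
open import Data.Product using (Σ; ∃; ∃-syntax; _×_; _,_)
open import Data.Sum using (_⊎_; inj₁; inj₂)
open import Data.Empty using (⊥)
open import Data.Unit using (⊤)
open import Relation.Nullary using (¬_)
open import Relation.Binary.PropositionalEquality using (_≡_; _≢_)
open import Relation.Binary.Construct.Closure.ReflexiveTransitive using (Star)

Digraph : ℕ → Set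
Digraph n = Fin n → Fin n → Bool

module _ {n : ℕ} (E : Digraph n) where

  Edge : Fin n → Fin n → Set
  Edge x y = E x y ≡ true

  Adj : Fin n → Fin n → Set
  Adj x y = Edge x y ⊎ Edge y x

  BiEdge : Fin n → Fin n → Set
  BiEdge x y = Edge x y × Edge y x

  IsReflexive : Set
  IsReflexive = ∀ x → Edge x x

  IsSymmetric : Set
  IsSymmetric = ∀ x y → Edge x y → Edge y x

  IsAntisymmetric : Set
  IsAntisymmetric = ∀ x y → Edge x y → Edge y x → x ≡ y

  Improper : Set
  Improper = ¬ IsSymmetric × ¬ IsAntisymmetric

  IsTransitive : Set
  IsTransitive = ∀ x y z → Edge x y → Edge y z → Edge x z

  IsQuasiorder : Set
  IsQuasiorder = IsReflexive × IsTransitive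

  θ : Fin n → Fin n → Set
  θ = Star BiEdge

  WeakConn : Fin n → Fin n → Set
  WeakConn = Star Adj

  IsEndo : (Fin n → Fin n) → Set
  IsEndo g = ∀ x y → Edge x y → Edge (g x) (g y)

  IsHomOn : Subset n → Subset n → (Fin n → Fin n) → Set
  IsHomOn U W f = (∀ x → x ∈ U → f x ∈ W)
                × (∀ x y → x ∈ U → y ∈ U → Edge x y → Edge (f x) (f y))

  HomHomogeneous : Set
  HomHomogeneous =
    ∀ (U W : Subset n) → Nonempty U → Nonempty W →
    ∀ (f : Fin n → Fin n) → IsHomOn U W f →
    ∃[ g ] (IsEndo g × (∀ x → x ∈ U → g x ≡ f x))

  -- no back-and-forth: for θ-classes S = [a], T = [b], S ⇄ T implies S = T
  NoBackAndForth : Set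
  NoBackAndForth =
    ∀ a b →
    (∃[ s ] ∃[ t ] (θ a s × θ b t × Edge s t)) →
    (∃[ s ] ∃[ t ] (θ a s × θ b t × Edge t s)) →
    θ a b

-- R (an equivalence relation on Fin n) has exactly k classes:
-- there is a system of k pairwise inequivalent representatives covering Fin n.
NumClasses : {n : ℕ} → (Fin n → Fin n → Set) → ℕ → Set
NumClasses {n} R k =
  Σ (Fin k → Fin n) λ r →
    (∀ i j → R (r i) (r j) → i ≡ j) × (∀ x → ∃[ i ] R x (r i))

-- ω(D) < |V / θ(D)|
BidirDisconnected : {n : ℕ} → Digraph n → Set
BidirDisconnected E =
  ∃[ w ] ∃[ t ] (NumClasses (WeakConn E) w × NumClasses (θ E) t × w < t)

-- D is an inflation of the digraph R (vertex type A): the map π : Fin n → A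
-- sends each vertex to the index i with x ∈ V_i; the V_i are nonempty
-- (π surjective), and edges are exactly as in the definition of inflation.
IsInflationOf : {n : ℕ} → Digraph n → {A : Set} → (A → A → Set) → Set
IsInflationOf {n} E {A} R =
  Σ (Fin n → A) λ π →
    (∀ a → ∃[ x ] π x ≡ a) ×
    (∀ x y → (Edge E x y → (π x ≡ π y ⊎ (π x ≢ π y × R (π x) (π y))))
           × ((π x ≡ π y ⊎ (π x ≢ π y × R (π x) (π y))) → Edge E x y))

C3∘ : Fin 3 → Fin 3 → Set
C3∘ zero zero = ⊤
C3∘ zero (suc zero) = ⊤
C3∘ zero (suc (suc zero)) = ⊥
C3∘ (suc zero) zero = ⊥
C3∘ (suc zero) (suc zero) = ⊤
C3∘ (suc zero) (suc (suc zero)) = ⊤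
C3∘ (suc (suc zero)) zero = ⊤
C3∘ (suc (suc zero)) (suc zero) = ⊥
C3∘ (suc (suc zero)) (suc (suc zero)) = ⊤

KC3L1 : ℕ → ℕ → Set
KC3L1 k l = (Fin k × Fin 3) ⊎ Fin l

kC3+l1 : (k l : ℕ) → KC3L1 k l → KC3L1 k l → Set
kC3+l1 k l (inj₁ (a , i)) (inj₁ (b , j)) = a ≡ b × C3∘ i j
kC3+l1 k l (inj₁ _) (inj₂ _) = ⊥
kC3+l1 k l (inj₂ _) (inj₁ _) = ⊥
kC3+l1 k l (inj₂ a) (inj₂ b) = a ≡ b

module Submission where

-- Bidirectional disconnectedness gives an edge u ⟶ v leaving its θ-class. A gap
-- a ⇄ b ⇄ c with no edge a ⟶ c could be mapped onto u, v, joining them by a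
-- ⇄-path; so θ-classes are cliques, and with no back-and-forth every edge between
-- two classes is present between all their members. If D is not transitive,
-- homogeneity turns a gap x ⟶ y ⟶ z into a triangle t₀ ⟶ t₁ ⟶ t₂ ⟶ t₀ with
-- t₀ ⟶ t₁ one-way; mapping t₀ ⟶ t₁ onto any one-way edge closes it into a
-- triangle too. From this, adjacency is an equivalence relation, a component
-- without one-way edges is a single θ-class, and a component with one splits
-- into three θ-classes lying at, after and before a chosen root, as in C₃°.
-- Conversely, in an inflation of k·C₃° + l·1° a homomorphism between induced
-- subdigraphs descends to a partial homomorphism on blocks; that extends around
-- each cycle by stepping after a known predecessor or before a known successor,
-- and lifts back through a section of the inflation.

open import Defs
open import Data.Nat as ℕ using (ℕ; _+_; _≤_; s≤s; z≤n)
open import Data.Nat.Properties using (≤-trans; m≤m+n)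
open import Data.Fin as Fin using (Fin; zero; suc)
open import Data.Fin.Properties using (any?; pigeonhole; <⇒≢; toℕ<n)
open import Data.Fin.Subset using (Subset; _∈_) renaming (⊤ to full)
open import Data.Fin.Subset.Properties using (∈⊤; _∈?_)
open import Data.List using (List; _∷_; length; lookup; filter; allFin)
open import Data.List.Properties using (filter-≐)
open import Data.List.Membership.Propositional using () renaming (_∈_ to _∈ˡ_)
open import Data.List.Membership.Propositional.Properties using (∈-lookup; ∈-filter⁺; ∈-filter⁻; ∈-allFin)
open import Data.List.Relation.Unary.All as All using ()
open import Data.List.Relation.Unary.AllPairs using (_∷_)
open import Data.List.Relation.Unary.Any as Any using (here)
open import Data.List.Relation.Unary.Any.Properties using (lookup-index)
open import Data.List.Relation.Unary.Unique.Propositional using (Unique)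
open import Data.List.Relation.Unary.Unique.Propositional.Properties using (allFin⁺; filter⁺)
open import Data.Vec using (tabulate)
open import Data.Vec.Properties using (lookup∘tabulate; lookup⇒[]=; []=⇒lookup)
open import Data.Bool as Bool using (true)
open import Data.Maybe using (Maybe; just; nothing)
open import Data.Product using (Σ; ∃; ∃-syntax; _×_; _,_; proj₁; proj₂)
import Data.Product.Properties as Product
open import Data.Sum using (_⊎_; inj₁; inj₂; [_,_])
import Data.Sum as Sum
import Data.Sum.Properties as SumProps
open import Data.Empty using (⊥; ⊥-elim)
open import Data.Unit using (⊤; tt)
open import Function using (_∘_)
open import Function.Bundles using (_⇔_; mk⇔; Equivalence)
open import Relation.Nullary using (¬_; Dec; yes; no; does; contradiction)
open import Relation.Nullary.Decidable using (dec-true; decidable-stable; _×-dec_; _⊎-dec_; ¬?)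
open import Relation.Unary using (Pred; Decidable)
open import Relation.Binary using (DecidableEquality)
open import Relation.Binary.PropositionalEquality
  using (_≡_; _≢_; refl; sym; trans; cong; cong₂; subst; subst₂)
open import Relation.Binary.Construct.Closure.ReflexiveTransitive using (ε; _◅_; _◅◅_; reverse)

lookup-injective : ∀ {A : Set} {xs : List A} → Unique xs →
                   ∀ i j → lookup xs i ≡ lookup xs j → i ≡ j
lookup-injective (_  ∷ _)  zero    zero    _  = refl
lookup-injective (x∉ ∷ _)  zero    (suc j) eq = contradiction eq (All.lookup x∉ (∈-lookup j))
lookup-injective (x∉ ∷ _)  (suc i) zero    eq = contradiction (sym eq) (All.lookup x∉ (∈-lookup i))
lookup-injective (_  ∷ u)  (suc i) (suc j) eq = cong suc (lookup-injective u i j eq)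

record Enumeration {m : ℕ} (P : Pred (Fin m) _) : Set where
  field
    size       : ℕ
    at         : Fin size → Fin m
    at-injective : ∀ i j → at i ≡ at j → i ≡ j
    at-P       : ∀ i → P (at i)
    index      : ∀ x → P x → Fin size
    at-index   : ∀ x p → at (index x p) ≡ x

  index-cong : ∀ {x y} → x ≡ y → ∀ p q → index x p ≡ index y q
  index-cong {x} refl p q = at-injective _ _ (trans (at-index x p) (sym (at-index x q)))

  index-injective : ∀ {x y} p q → index x p ≡ index y q → x ≡ y
  index-injective {x} {y} p q eq = trans (sym (at-index x p)) (trans (cong at eq) (at-index y q))

  index-at : ∀ i p → index (at i) p ≡ i
  index-at i p = at-injective _ _ (at-index (at i) p)

enumerate : ∀ {m} {P : Pred (Fin m) _} → Decidable P → Enumeration P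
enumerate {m} {P} P? = record
  { size = length members
  ; at = lookup members
  ; at-injective = lookup-injective (filter⁺ P? (allFin⁺ m))
  ; at-P = λ i → proj₂ (∈-filter⁻ P? {xs = allFin m} (∈-lookup i))
  ; index = λ x p → Any.index (member x p)
  ; at-index = λ x p → sym (lookup-index (member x p))
  }
  where
  members : List (Fin m)
  members = filter P? (allFin m)
  member : ∀ x → P x → x ∈ˡ members
  member x p = ∈-filter⁺ P? (∈-allFin x) p

module CanonicalRepresentative
  {n : ℕ} {_∼_ : Fin n → Fin n → Set} (∼? : ∀ x y → Dec (x ∼ y))
  (∼-refl : ∀ x → x ∼ x) (∼-sym : ∀ {x y} → x ∼ y → y ∼ x)
  (∼-trans : ∀ {x y z} → x ∼ y → y ∼ z → x ∼ z) where

  private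
    class : Fin n → List (Fin n)
    class x = filter (∼? x) (allFin n)

    first : (xs : List (Fin n)) → ∀ {x} → x ∈ˡ xs → Fin n
    first (y ∷ _) _ = y

    first-∈ : ∀ xs {x} (p : x ∈ˡ xs) → first xs p ∈ˡ xs
    first-∈ (_ ∷ _) _ = here refl

    first-cong : ∀ {xs ys} → xs ≡ ys → ∀ {x y} (p : x ∈ˡ xs) (q : y ∈ˡ ys) → first xs p ≡ first ys q
    first-cong {_ ∷ _} refl _ _ = refl

    ∈-class : ∀ x → x ∈ˡ class x
    ∈-class x = ∈-filter⁺ (∼? x) (∈-allFin x) (∼-refl x)

  canon : Fin n → Fin n
  canon x = first (class x) (∈-class x)

  ∼-canon : ∀ x → x ∼ canon x
  ∼-canon x = proj₂ (∈-filter⁻ (∼? x) {xs = allFin n} (first-∈ (class x) (∈-class x)))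

  canon-cong : ∀ {x y} → x ∼ y → canon x ≡ canon y
  canon-cong {x} {y} x∼y = first-cong same-class (∈-class x) (∈-class y)
    where
    same-class : class x ≡ class y
    same-class = filter-≐ (∼? x) (∼? y) ((∼-trans (∼-sym x∼y)) , ∼-trans x∼y) (allFin n)

  canon-idem : ∀ x → canon (canon x) ≡ canon x
  canon-idem x = sym (canon-cong (∼-canon x))

module DigraphBasics {n : ℕ} (E : Digraph n) where

  infix 4 _⟶_ _⇄_
  _⟶_ : Fin n → Fin n → Set
  _⟶_ = Edge E

  _⇄_ : Fin n → Fin n → Set
  _⇄_ = BiEdge E

  edge? : ∀ x y → Dec (x ⟶ y)
  edge? x y = E x y Bool.≟ true

  OneWay : Fin n → Fin n → Set
  OneWay x y = x ⟶ y × ¬ (y ⟶ x)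

  ⇄-sym : ∀ {x y} → x ⇄ y → y ⇄ x
  ⇄-sym (xy , yx) = yx , xy

  Adj-sym : ∀ {x y} → Adj E x y → Adj E y x
  Adj-sym (inj₁ xy) = inj₂ xy
  Adj-sym (inj₂ yx) = inj₁ yx

  data AdjKind (x y : Fin n) : Set where
    both     : x ⇄ y → AdjKind x y
    forward  : OneWay x y → AdjKind x y
    backward : OneWay y x → AdjKind x y

  adjKind : ∀ {x y} → Adj E x y → AdjKind x y
  adjKind {x} {y} xy with edge? x y | edge? y x
  ... | yes p | yes q = both (p , q)
  ... | yes p | no ¬q = forward (p , ¬q)
  ... | no ¬p | yes q = backward (q , ¬p)
  ... | no ¬p | no ¬q = ⊥-elim ([ ¬p , ¬q ] xy)

  endo-⟶ : ∀ {g x y x′ y′} → IsEndo E g → g x ≡ x′ → g y ≡ y′ → x ⟶ y → x′ ⟶ y′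
  endo-⟶ {x = x} {y} endo refl refl xy = endo x y xy

  endo-⇄ : ∀ {g x y x′ y′} → IsEndo E g → g x ≡ x′ → g y ≡ y′ → x ⇄ y → x′ ⇄ y′
  endo-⇄ endo gx gy (xy , yx) = endo-⟶ endo gx gy xy , endo-⟶ endo gy gx yx

  image : ∀ {m} → (Fin m → Fin n) → Subset n
  image a = tabulate (λ x → does (any? (λ i → a i Fin.≟ x)))

  ∈-image⁺ : ∀ {m} (a : Fin m → Fin n) i → a i ∈ image a
  ∈-image⁺ a i = lookup⇒[]= (a i) (image a)
    (trans (lookup∘tabulate _ (a i)) (dec-true (any? (λ j → a j Fin.≟ a i)) (i , refl)))

  ∈-image⁻ : ∀ {m} (a : Fin m → Fin n) x → x ∈ image a → ∃[ i ] a i ≡ x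
  ∈-image⁻ a x x∈ = witness (any? (λ i → a i Fin.≟ x))
    (trans (sym (lookup∘tabulate _ x)) ([]=⇒lookup x∈))
    where
    witness : (d : Dec (∃[ i ] a i ≡ x)) → does d ≡ true → ∃[ i ] a i ≡ x
    witness (yes w) _ = w

  extend-points : HomHomogeneous E → ∀ {m} (a b : Fin (ℕ.suc m) → Fin n) →
                  (∀ i j → a i ≡ a j → i ≡ j) → (∀ i j → a i ⟶ a j → b i ⟶ b j) →
                  ∃[ g ] (IsEndo E g × ∀ i → g (a i) ≡ b i)
  extend-points hh a b a-inj hom =
    restrict (hh (image a) full (a zero , ∈-image⁺ a zero) (a zero , ∈⊤) f ((λ _ _ → ∈⊤) , f-hom))
    where
    f : Fin n → Fin n
    f x with any? (λ i → a i Fin.≟ x)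
    ... | yes (i , _) = b i
    ... | no _ = x

    f-at : ∀ {i x} → a i ≡ x → f x ≡ b i
    f-at {i} {x} ai≡x with any? (λ j → a j Fin.≟ x)
    ... | yes (j , aj≡x) = cong b (a-inj j i (trans aj≡x (sym ai≡x)))
    ... | no none = contradiction (i , ai≡x) none

    f-hom : ∀ x y → x ∈ image a → y ∈ image a → x ⟶ y → f x ⟶ f y
    f-hom x y x∈ y∈ xy with ∈-image⁻ a x x∈ | ∈-image⁻ a y y∈
    ... | i , refl | j , refl = subst₂ _⟶_ (sym (f-at refl)) (sym (f-at refl)) (hom i j xy)

    restrict : ∃[ g ] (IsEndo E g × (∀ x → x ∈ image a → g x ≡ f x)) →
               ∃[ g ] (IsEndo E g × ∀ i → g (a i) ≡ b i)
    restrict (g , endo , agrees) = g , endo , λ i → trans (agrees (a i) (∈-image⁺ a i)) (f-at refl)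

module Extensions {n : ℕ} {E : Digraph n} (rf : IsReflexive E) (hh : HomHomogeneous E) where
  open DigraphBasics E

  private
    ⟨_∣_⟩ : Fin n → Fin n → Fin 2 → Fin n
    ⟨ x ∣ y ⟩ zero       = x
    ⟨ x ∣ y ⟩ (suc zero) = y

    ⟨_∣_∣_⟩ : Fin n → Fin n → Fin n → Fin 3 → Fin n
    ⟨ x ∣ y ∣ z ⟩ zero             = x
    ⟨ x ∣ y ∣ z ⟩ (suc zero)       = y
    ⟨ x ∣ y ∣ z ⟩ (suc (suc zero)) = z

  ¬⟶⇒≢ : ∀ {x y} → ¬ (x ⟶ y) → x ≢ y
  ¬⟶⇒≢ ¬xy refl = ¬xy (rf _)

  ¬⟵⇒≢ : ∀ {x y} → ¬ (y ⟶ x) → x ≢ y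
  ¬⟵⇒≢ ¬yx refl = ¬yx (rf _)

  extend₂ : ∀ {a b a′ b′} → a ≢ b → (a ⟶ b → a′ ⟶ b′) → (b ⟶ a → b′ ⟶ a′) →
            ∃[ g ] (IsEndo E g × g a ≡ a′ × g b ≡ b′)
  extend₂ {a} {b} {a′} {b′} a≢b ab ba
    with extend-points hh ⟨ a ∣ b ⟩ ⟨ a′ ∣ b′ ⟩ distinct hom
    where
    distinct : ∀ i j → ⟨ a ∣ b ⟩ i ≡ ⟨ a ∣ b ⟩ j → i ≡ j
    distinct zero       zero       _  = refl
    distinct zero       (suc zero) eq = contradiction eq a≢b
    distinct (suc zero) zero       eq = contradiction (sym eq) a≢b
    distinct (suc zero) (suc zero) _  = refl

    hom : ∀ i j → ⟨ a ∣ b ⟩ i ⟶ ⟨ a ∣ b ⟩ j → ⟨ a′ ∣ b′ ⟩ i ⟶ ⟨ a′ ∣ b′ ⟩ j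
    hom zero       zero       _ = rf a′
    hom zero       (suc zero) e = ab e
    hom (suc zero) zero       e = ba e
    hom (suc zero) (suc zero) _ = rf b′
  ... | g , endo , at = g , endo , at zero , at (suc zero)

  extend₃ : ∀ {a b c a′ b′ c′} → a ≢ b → a ≢ c → b ≢ c →
            (a ⟶ b → a′ ⟶ b′) → (b ⟶ a → b′ ⟶ a′) →
            (a ⟶ c → a′ ⟶ c′) → (c ⟶ a → c′ ⟶ a′) →
            (b ⟶ c → b′ ⟶ c′) → (c ⟶ b → c′ ⟶ b′) →
            ∃[ g ] (IsEndo E g × g a ≡ a′ × g b ≡ b′ × g c ≡ c′)
  extend₃ {a} {b} {c} {a′} {b′} {c′} a≢b a≢c b≢c ab ba ac ca bc cb
    with extend-points hh ⟨ a ∣ b ∣ c ⟩ ⟨ a′ ∣ b′ ∣ c′ ⟩ distinct hom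
    where
    distinct : ∀ i j → ⟨ a ∣ b ∣ c ⟩ i ≡ ⟨ a ∣ b ∣ c ⟩ j → i ≡ j
    distinct zero             zero             _  = refl
    distinct zero             (suc zero)       eq = contradiction eq a≢b
    distinct zero             (suc (suc zero)) eq = contradiction eq a≢c
    distinct (suc zero)       zero             eq = contradiction (sym eq) a≢b
    distinct (suc zero)       (suc zero)       _  = refl
    distinct (suc zero)       (suc (suc zero)) eq = contradiction eq b≢c
    distinct (suc (suc zero)) zero             eq = contradiction (sym eq) a≢c
    distinct (suc (suc zero)) (suc zero)       eq = contradiction (sym eq) b≢c
    distinct (suc (suc zero)) (suc (suc zero)) _  = refl

    hom : ∀ i j → ⟨ a ∣ b ∣ c ⟩ i ⟶ ⟨ a ∣ b ∣ c ⟩ j →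
          ⟨ a′ ∣ b′ ∣ c′ ⟩ i ⟶ ⟨ a′ ∣ b′ ∣ c′ ⟩ j
    hom zero             zero             _ = rf a′
    hom zero             (suc zero)       e = ab e
    hom zero             (suc (suc zero)) e = ac e
    hom (suc zero)       zero             e = ba e
    hom (suc zero)       (suc zero)       _ = rf b′
    hom (suc zero)       (suc (suc zero)) e = bc e
    hom (suc (suc zero)) zero             e = ca e
    hom (suc (suc zero)) (suc zero)       e = cb e
    hom (suc (suc zero)) (suc (suc zero)) _ = rf c′
  ... | g , endo , at = g , endo , at zero , at (suc zero) , at (suc (suc zero))

CrossEdge : ∀ {n} → Digraph n → Set
CrossEdge E = ∃[ u ] ∃[ v ] (Edge E u v × ¬ θ E u v)

module Structure {n : ℕ} {E : Digraph n} (rf : IsReflexive E) (hh : HomHomogeneous E)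
                 (nbf : NoBackAndForth E) (cross : ¬ ¬ CrossEdge E) where
  open DigraphBasics E
  open Extensions rf hh

  ⇄-refl : ∀ {x} → x ⇄ x
  ⇄-refl = rf _ , rf _

  gap⇒¬cross : ∀ {a b c} → a ⇄ b → b ⇄ c → ¬ (a ⟶ c) → ¬ CrossEdge E
  gap⇒¬cross {a} {b} {c} ab bc ¬ac (u , v , uv , ¬θuv) with edge? c a
  ... | yes _ with extend₂ {a} {c} {v} {u} (¬⟶⇒≢ ¬ac) (⊥-elim ∘ ¬ac) (λ _ → uv)
  ...   | g , endo , ga , gc =
    ¬θuv (endo-⇄ endo gc refl (⇄-sym bc) ◅ endo-⇄ endo refl ga (⇄-sym ab) ◅ ε)
  gap⇒¬cross {a} {b} {c} ab bc ¬ac (u , v , uv , ¬θuv) | no ¬ca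
    with extend₂ {a} {c} {u} {v} (¬⟶⇒≢ ¬ac) (⊥-elim ∘ ¬ac) (⊥-elim ∘ ¬ca)
  ... | g , endo , ga , gc = ¬θuv (endo-⇄ endo ga refl ab ◅ endo-⇄ endo refl gc bc ◅ ε)

  ⇄-trans : ∀ {a b c} → a ⇄ b → b ⇄ c → a ⇄ c
  ⇄-trans ab bc = chain ab bc , chain (⇄-sym bc) (⇄-sym ab)
    where
    chain : ∀ {a b c} → a ⇄ b → b ⇄ c → a ⟶ c
    chain ab bc = decidable-stable (edge? _ _) (λ ¬ac → cross (gap⇒¬cross ab bc ¬ac))

  θ⇒⇄ : ∀ {x y} → θ E x y → x ⇄ y
  θ⇒⇄ ε       = ⇄-refl
  θ⇒⇄ (p ◅ q) = ⇄-trans p (θ⇒⇄ q)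

  no-back-and-forth : ∀ {a b s t s′ t′} → a ⇄ s → b ⇄ t → s ⟶ t →
                      a ⇄ s′ → b ⇄ t′ → t′ ⟶ s′ → a ⇄ b
  no-back-and-forth as bt st as′ bt′ t′s′ =
    θ⇒⇄ (nbf _ _ (_ , _ , as ◅ ε , bt ◅ ε , st) (_ , _ , as′ ◅ ε , bt′ ◅ ε , t′s′))

  -- If a′ and b were non-adjacent, swapping them would turn a ⟶ b into an
  -- edge back from the class of b to that of a′.
  oneWay-tail-⇄ : ∀ {a b a′} → OneWay a b → a ⇄ a′ → a′ ⟶ b
  oneWay-tail-⇄ {a} {b} {a′} (ab , ¬ba) aa′ with edge? a′ b
  ... | yes a′b = a′b
  ... | no ¬a′b with edge? b a′
  ... | yes ba′ = contradiction (proj₂ (no-back-and-forth ⇄-refl ⇄-refl ab aa′ ⇄-refl ba′)) ¬ba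
  ... | no ¬ba′ with extend₂ {a′} {b} {b} {a′} (¬⟶⇒≢ ¬a′b) (⊥-elim ∘ ¬a′b) (⊥-elim ∘ ¬ba′)
  ... | g , endo , ga′ , gb = proj₁ (no-back-and-forth (⇄-sym aa′) ⇄-refl ab
                                       ⇄-refl (endo-⇄ endo ga′ refl (⇄-sym aa′)) (endo-⟶ endo refl gb ab))

  oneWay-head-⇄ : ∀ {a b b′} → OneWay a b → b ⇄ b′ → a ⟶ b′
  oneWay-head-⇄ {a} {b} {b′} (ab , ¬ba) bb′ with edge? a b′
  ... | yes ab′ = ab′
  ... | no ¬ab′ with edge? b′ a
  ... | yes b′a = contradiction (proj₂ (no-back-and-forth ⇄-refl ⇄-refl ab ⇄-refl bb′ b′a)) ¬ba
  ... | no ¬b′a with extend₂ {a} {b′} {b′} {a} (¬⟶⇒≢ ¬ab′) (⊥-elim ∘ ¬ab′) (⊥-elim ∘ ¬b′a)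
  ... | g , endo , ga , gb′ = proj₁ (no-back-and-forth ⇄-refl (⇄-sym bb′) ab
                                       (endo-⇄ endo gb′ refl (⇄-sym bb′)) ⇄-refl (endo-⟶ endo ga refl ab))

  ⟶-resp-⇄ : ∀ {x y x′ y′} → x ⟶ y → x ⇄ x′ → y ⇄ y′ → x′ ⟶ y′
  ⟶-resp-⇄ {x} {y} {x′} xy xx′ yy′ with edge? y x
  ... | yes yx = proj₁ (⇄-trans (⇄-trans (⇄-sym xx′) (xy , yx)) yy′)
  ... | no ¬yx = oneWay-head-⇄ (x′y , ¬yx′) yy′
    where
    x′y : x′ ⟶ y
    x′y = oneWay-tail-⇄ (xy , ¬yx) xx′
    ¬yx′ : ¬ (y ⟶ x′)
    ¬yx′ yx′ = ¬yx (proj₁ (⇄-trans (yx′ , x′y) (⇄-sym xx′)))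

  ⟶-respˡ-⇄ : ∀ {x y x′} → x ⟶ y → x ⇄ x′ → x′ ⟶ y
  ⟶-respˡ-⇄ xy xx′ = ⟶-resp-⇄ xy xx′ ⇄-refl

  ⟶-respʳ-⇄ : ∀ {x y y′} → x ⟶ y → y ⇄ y′ → x ⟶ y′
  ⟶-respʳ-⇄ xy yy′ = ⟶-resp-⇄ xy ⇄-refl yy′

  oneWay-respˡ-⇄ : ∀ {x y x′} → OneWay x y → x ⇄ x′ → OneWay x′ y
  oneWay-respˡ-⇄ (xy , ¬yx) xx′ = ⟶-respˡ-⇄ xy xx′ , λ yx′ → ¬yx (⟶-respʳ-⇄ yx′ (⇄-sym xx′))

  oneWay-respʳ-⇄ : ∀ {x y y′} → OneWay x y → y ⇄ y′ → OneWay x y′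
  oneWay-respʳ-⇄ (xy , ¬yx) yy′ = ⟶-respʳ-⇄ xy yy′ , λ y′x → ¬yx (⟶-respˡ-⇄ y′x (⇄-sym yy′))

  oneWay-triangle : ∀ {a b c} → OneWay a b → b ⟶ c → c ⟶ a → OneWay b c × OneWay c a
  oneWay-triangle (ab , ¬ba) bc ca =
    (bc , λ cb → ¬ba (⟶-respˡ-⇄ ca (cb , bc))) , (ca , λ ac → ¬ba (⟶-respʳ-⇄ bc (ca , ac)))

  Triangle : Set
  Triangle = ∃[ a ] ∃[ b ] ∃[ c ] (OneWay a b × b ⟶ c × c ⟶ a)

  -- Without the edge z ⟶ x, swap x and z to get z ⟶ g y ⟶ x, then fold
  -- x, y, z onto x, x, y to close the triangle x ⟶ y ⟶ h (g y) ⟶ x.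
  ¬transitive⇒triangle : ∀ {x y z} → x ⟶ y → y ⟶ z → ¬ (x ⟶ z) → Triangle
  ¬transitive⇒triangle {x} {y} {z} xy yz ¬xz = close (edge? z x)
    where
    ¬yx : ¬ (y ⟶ x)
    ¬yx yx = ¬xz (⟶-respˡ-⇄ yz (yx , xy))
    ¬zy : ¬ (z ⟶ y)
    ¬zy zy = ¬xz (⟶-respʳ-⇄ xy (yz , zy))

    close : Dec (z ⟶ x) → Triangle
    close (yes zx) = x , y , z , (xy , ¬yx) , yz , zx
    close (no ¬zx)
      with extend₂ {x} {z} {z} {x} (¬⟶⇒≢ ¬xz) (⊥-elim ∘ ¬xz) (⊥-elim ∘ ¬zx)
         | extend₃ {x} {y} {z} {x} {x} {y} (¬⟵⇒≢ ¬yx) (¬⟶⇒≢ ¬xz) (¬⟵⇒≢ ¬zy)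
                   (λ _ → rf x) (⊥-elim ∘ ¬yx) (⊥-elim ∘ ¬xz) (⊥-elim ∘ ¬zx) (λ _ → xy) (⊥-elim ∘ ¬zy)
    ... | g , g-endo , gx , gz | h , h-endo , hx , hy , hz =
      x , y , h (g y) , (xy , ¬yx) , endo-⟶ h-endo hz refl (endo-⟶ g-endo gx refl xy)
                                 , endo-⟶ h-endo refl hx (endo-⟶ g-endo refl gz yz)

  module WithTriangle {t₀ t₁ t₂ : Fin n} (t₀t₁ : OneWay t₀ t₁) (t₁t₂ : t₁ ⟶ t₂) (t₂t₀ : t₂ ⟶ t₀) where

    complete-triangle : ∀ {a b} → OneWay a b → ∃[ c ] (b ⟶ c × c ⟶ a)
    complete-triangle {a} {b} (ab , _)
      with extend₂ {t₀} {t₁} {a} {b} (¬⟵⇒≢ (proj₂ t₀t₁)) (λ _ → ab) (⊥-elim ∘ proj₂ t₀t₁)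
    ... | g , endo , g₀ , g₁ = g t₂ , endo-⟶ endo g₁ refl t₁t₂ , endo-⟶ endo refl g₀ t₂t₀

    oneWay-path-closes : ∀ {x y z} → OneWay x y → OneWay y z → z ⟶ x
    oneWay-path-closes {x} {y} {z} (xy , ¬yx) (yz , ¬zy) =
      decidable-stable (edge? z x) (λ ¬zx → refute ¬zx (complete-triangle (xy , ¬yx)))
      where
      refute : ¬ (z ⟶ x) → ∃[ t ] (y ⟶ t × t ⟶ x) → ⊥
      refute ¬zx (t , yt , tx) with proj₂ (proj₂ (oneWay-triangle (xy , ¬yx) yt tx)) | edge? z t | edge? t z
      ... | _ | yes zt | _
        with extend₃ {x} {y} {z} {x} {x} {y} (¬⟵⇒≢ ¬yx) (¬⟵⇒≢ ¬zx) (¬⟵⇒≢ ¬zy)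
               (λ _ → rf x) (⊥-elim ∘ ¬yx) (λ _ → xy) (⊥-elim ∘ ¬zx) (λ _ → xy) (⊥-elim ∘ ¬zy)
      ...   | g , endo , gx , gy , gz =
        ¬yx (⟶-respʳ-⇄ (endo-⟶ endo gz refl zt) (endo-⟶ endo refl gx tx , endo-⟶ endo gy refl yt))
      refute ¬zx (t , yt , tx) | _ | no _ | yes tz
        with extend₃ {x} {y} {z} {x} {y} {y} (¬⟵⇒≢ ¬yx) (¬⟵⇒≢ ¬zx) (¬⟵⇒≢ ¬zy)
               (λ _ → xy) (⊥-elim ∘ ¬yx) (λ _ → xy) (⊥-elim ∘ ¬zx) (λ _ → rf y) (⊥-elim ∘ ¬zy)
      ...   | g , endo , gx , gy , gz =
        ¬yx (⟶-respˡ-⇄ (endo-⟶ endo refl gx tx) (endo-⟶ endo refl gz tz , endo-⟶ endo gy refl yt))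
      refute ¬zx (t , yt , tx) | ¬xt | no ¬zt | no ¬tz
        with extend₃ {x} {z} {t} {x} {x} {t} (¬⟵⇒≢ ¬zx) (¬⟶⇒≢ ¬xt) (¬⟶⇒≢ ¬zt)
               (λ _ → rf x) (⊥-elim ∘ ¬zx) (⊥-elim ∘ ¬xt) (λ tx → tx) (⊥-elim ∘ ¬zt) (⊥-elim ∘ ¬tz)
      ...   | g , endo , gx , gz , gt =
        ¬xt (⟶-respˡ-⇄ (endo-⟶ endo refl gt yt) (endo-⟶ endo refl gz yz , endo-⟶ endo gx refl xy))

    oneWay-out-⇄ : ∀ {a b b′} → OneWay a b → OneWay a b′ → b ⇄ b′
    oneWay-out-⇄ {a} {b} {b′} (ab , ¬ba) (ab′ , ¬b′a) with edge? b b′ | edge? b′ b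
    ... | yes bb′ | yes b′b = bb′ , b′b
    ... | yes bb′ | no ¬b′b = contradiction (oneWay-path-closes (ab , ¬ba) (bb′ , ¬b′b)) ¬b′a
    ... | no ¬bb′ | yes b′b = contradiction (oneWay-path-closes (ab′ , ¬b′a) (b′b , ¬bb′)) ¬ba
    ... | no ¬bb′ | no ¬b′b with complete-triangle (ab , ¬ba)
    ... | c , bc , ca
      with oneWay-path-closes (proj₂ (oneWay-triangle (ab , ¬ba) bc ca)) (ab′ , ¬b′a)
         | extend₃ {a} {b} {b′} {a} {a} {b} (¬⟵⇒≢ ¬ba) (¬⟵⇒≢ ¬b′a) (¬⟶⇒≢ ¬bb′)
                   (λ _ → rf a) (⊥-elim ∘ ¬ba) (λ _ → ab) (⊥-elim ∘ ¬b′a) (⊥-elim ∘ ¬bb′) (⊥-elim ∘ ¬b′b)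
    ... | b′c | g , endo , ga , gb , gb′ =
      contradiction (⟶-respʳ-⇄ (endo-⟶ endo gb′ refl b′c) (endo-⟶ endo refl ga ca , endo-⟶ endo gb refl bc)) ¬ba

    oneWay-in-⇄ : ∀ {a b b′} → OneWay b a → OneWay b′ a → b ⇄ b′
    oneWay-in-⇄ {a} {b} {b′} (ba , ¬ab) (b′a , ¬ab′) with edge? b b′ | edge? b′ b
    ... | yes bb′ | yes b′b = bb′ , b′b
    ... | yes bb′ | no ¬b′b = contradiction (oneWay-path-closes (bb′ , ¬b′b) (b′a , ¬ab′)) ¬ab
    ... | no ¬bb′ | yes b′b = contradiction (oneWay-path-closes (b′b , ¬bb′) (ba , ¬ab)) ¬ab′
    ... | no ¬bb′ | no ¬b′b with complete-triangle (ba , ¬ab)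
    ... | c , ac , cb
      with oneWay-path-closes (b′a , ¬ab′) (proj₁ (oneWay-triangle (ba , ¬ab) ac cb))
         | extend₃ {a} {b} {b′} {a} {a} {b} (¬⟶⇒≢ ¬ab) (¬⟶⇒≢ ¬ab′) (¬⟶⇒≢ ¬bb′)
                   (⊥-elim ∘ ¬ab) (λ _ → rf a) (⊥-elim ∘ ¬ab′) (λ _ → ba) (⊥-elim ∘ ¬bb′) (⊥-elim ∘ ¬b′b)
    ... | cb′ | g , endo , ga , gb , gb′ =
      contradiction (⟶-respˡ-⇄ (endo-⟶ endo refl gb′ cb′) (endo-⟶ endo refl gb cb , endo-⟶ endo ga refl ac)) ¬ab

    Adj-trans : ∀ {x y z} → Adj E x y → Adj E y z → Adj E x z
    Adj-trans xy yz with adjKind xy | adjKind yz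
    ... | both p     | _          = Sum.map (λ e → ⟶-respˡ-⇄ e (⇄-sym p)) (λ e → ⟶-respʳ-⇄ e (⇄-sym p)) yz
    ... | forward _  | both q     = Sum.map (λ e → ⟶-respʳ-⇄ e q) (λ e → ⟶-respˡ-⇄ e q) xy
    ... | backward _ | both q     = Sum.map (λ e → ⟶-respʳ-⇄ e q) (λ e → ⟶-respˡ-⇄ e q) xy
    ... | forward p  | forward q  = inj₂ (oneWay-path-closes p q)
    ... | forward p  | backward q = inj₁ (proj₁ (oneWay-in-⇄ p q))
    ... | backward p | forward q  = inj₁ (proj₁ (oneWay-out-⇄ p q))
    ... | backward p | backward q = inj₁ (oneWay-path-closes q p)

module _ {n : ℕ} {E : Digraph n} {A : Set} {R : A → A → Set}
         (_≟A_ : DecidableEquality A) (R-refl : ∀ a → R a a) where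

  inflation-intro : (π : Fin n → A) → (∀ a → ∃[ x ] π x ≡ a) →
                    (∀ x y → Edge E x y ⇔ R (π x) (π y)) → IsInflationOf E R
  inflation-intro π π-surjective edge⇔R = π , π-surjective , λ x y → to x y , from x y
    where
    to : ∀ x y → Edge E x y → π x ≡ π y ⊎ (π x ≢ π y × R (π x) (π y))
    to x y xy with π x ≟A π y
    ... | yes same = inj₁ same
    ... | no differ = inj₂ (differ , Equivalence.to (edge⇔R x y) xy)
    from : ∀ x y → π x ≡ π y ⊎ (π x ≢ π y × R (π x) (π y)) → Edge E x y
    from x y (inj₁ same) = Equivalence.from (edge⇔R x y) (subst (R (π x)) same (R-refl (π x)))
    from x y (inj₂ (_ , r)) = Equivalence.from (edge⇔R x y) r

  inflation-elim : ((π , _) : IsInflationOf E R) → ∀ x y → Edge E x y ⇔ R (π x) (π y)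
  inflation-elim (π , _ , edge-iff) x y = mk⇔ to from
    where
    to : Edge E x y → R (π x) (π y)
    to xy with proj₁ (edge-iff x y) xy
    ... | inj₁ same = subst (R (π x)) same (R-refl (π x))
    ... | inj₂ (_ , r) = r
    from : R (π x) (π y) → Edge E x y
    from r with π x ≟A π y
    ... | yes same = proj₂ (edge-iff x y) (inj₁ same)
    ... | no differ = proj₂ (edge-iff x y) (inj₂ (differ , r))

WhenDefined : {A : Set} → (A → A → Set) → Maybe A → Maybe A → Set
WhenDefined R (just a) (just b) = R a b
WhenDefined R _        _        = ⊤

ExtendsPartialHoms : {A : Set} → (A → A → Set) → Set
ExtendsPartialHoms {A} R =
  ∀ (h : A → Maybe A) → (∀ a b → R a b → WhenDefined R (h a) (h b)) →
  Σ (A → A) λ G → (∀ a b → R a b → R (G a) (G b)) × (∀ a b → h a ≡ just b → G a ≡ b)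

module _ {n : ℕ} {E : Digraph n} {A : Set} {R : A → A → Set}
         (_≟A_ : DecidableEquality A) (R-refl : ∀ a → R a a)
         (R-antisym : ∀ a b → R a b → R b a → a ≡ b) (R-extends : ExtendsPartialHoms R) where

  module Descent (infl : IsInflationOf E R) (U : Subset n) (f : Fin n → Fin n)
                 (f-hom : ∀ x y → x ∈ U → y ∈ U → Edge E x y → Edge E (f x) (f y)) where
    open DigraphBasics E using (_⟶_)

    π : Fin n → A
    π = proj₁ infl

    edge⇔R : ∀ x y → x ⟶ y ⇔ R (π x) (π y)
    edge⇔R = inflation-elim {E = E} {R = R} _≟A_ R-refl infl

    R⇒⟶ : ∀ {x y} → R (π x) (π y) → x ⟶ y
    R⇒⟶ = Equivalence.from (edge⇔R _ _)

    ⟶⇒R : ∀ {x y} → x ⟶ y → R (π x) (π y)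
    ⟶⇒R = Equivalence.to (edge⇔R _ _)

    h : A → Maybe A
    h c with any? (λ u → (u ∈? U) ×-dec (π u ≟A c))
    ... | yes (u , _) = just (π (f u))
    ... | no _        = nothing

    h-just : ∀ {c d} → h c ≡ just d → ∃[ u ] (u ∈ U × π u ≡ c × π (f u) ≡ d)
    h-just {c} eq with any? (λ u → (u ∈? U) ×-dec (π u ≟A c))
    h-just refl | yes (u , u∈U , πu) = u , u∈U , πu , refl

    -- Vertices of U in one block are joined both ways, so f sends them into one block.
    h-on-U : ∀ {u} → u ∈ U → h (π u) ≡ just (π (f u))
    h-on-U {u} u∈U with any? (λ v → (v ∈? U) ×-dec (π v ≟A π u))
    ... | yes (v , v∈U , πv) =
      cong just (R-antisym _ _ (⟶⇒R (f-hom v u v∈U u∈U (R⇒⟶ (subst (R (π v)) πv (R-refl (π v))))))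
                               (⟶⇒R (f-hom u v u∈U v∈U (R⇒⟶ (subst (R (π u)) (sym πv) (R-refl (π u)))))))
    ... | no none = contradiction (u , u∈U , refl) none

    h-hom : ∀ c d → R c d → WhenDefined R (h c) (h d)
    h-hom c d r with h c in hc | h d in hd
    ... | just c′ | just d′ with h-just hc | h-just hd
    ...   | u , u∈U , refl , refl | v , v∈U , refl , refl = ⟶⇒R (f-hom u v u∈U v∈U (R⇒⟶ r))
    h-hom c d r | just _  | nothing = tt
    h-hom c d r | nothing | _       = tt

  inflation-homHomogeneous : IsInflationOf E R → HomHomogeneous E
  inflation-homHomogeneous infl@(_ , π-surjective , _) U _ _ _ f (_ , f-hom) =
    g , g-endo , λ x x∈U → g-on-U (x ∈? U) x∈U
    where
    open Descent infl U f f-hom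

    G : A → A
    G = proj₁ (R-extends h h-hom)
    G-hom : ∀ a b → R a b → R (G a) (G b)
    G-hom = proj₁ (proj₂ (R-extends h h-hom))
    G-extends : ∀ a b → h a ≡ just b → G a ≡ b
    G-extends = proj₂ (proj₂ (R-extends h h-hom))

    g′ : ∀ x → Dec (x ∈ U) → Fin n
    g′ x (yes _) = f x
    g′ x (no _)  = proj₁ (π-surjective (G (π x)))

    g : Fin n → Fin n
    g x = g′ x (x ∈? U)

    π∘g′ : ∀ x (x∈U? : Dec (x ∈ U)) → π (g′ x x∈U?) ≡ G (π x)
    π∘g′ x (yes x∈U) = sym (G-extends _ _ (h-on-U x∈U))
    π∘g′ x (no _)    = proj₂ (π-surjective _)

    g-endo : IsEndo E g
    g-endo x y xy = R⇒⟶ (subst₂ R (sym (π∘g′ x (x ∈? U))) (sym (π∘g′ y (y ∈? U))) (G-hom _ _ (⟶⇒R xy)))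

    g-on-U : ∀ {x} (x∈U? : Dec (x ∈ U)) → x ∈ U → g′ x x∈U? ≡ f x
    g-on-U (yes _)  _   = refl
    g-on-U (no ∉U) x∈U = contradiction x∈U ∉U

module Cycles (k l : ℕ) where

  infix 4 _≟_
  _≟_ : DecidableEquality (KC3L1 k l)
  _≟_ = SumProps.≡-dec (Product.≡-dec Fin._≟_ Fin._≟_) Fin._≟_

  R-refl : ∀ a → kC3+l1 k l a a
  R-refl (inj₁ (_ , zero))             = refl , tt
  R-refl (inj₁ (_ , suc zero))         = refl , tt
  R-refl (inj₁ (_ , suc (suc zero)))   = refl , tt
  R-refl (inj₂ _)                      = refl

  private
    A : Set
    A = KC3L1 k l
    R : A → A → Set
    R = kC3+l1 k l

  next prev : A → A
  next (inj₁ (a , zero))           = inj₁ (a , suc zero)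
  next (inj₁ (a , suc zero))       = inj₁ (a , suc (suc zero))
  next (inj₁ (a , suc (suc zero))) = inj₁ (a , zero)
  next (inj₂ j)                    = inj₂ j
  prev (inj₁ (a , zero))           = inj₁ (a , suc (suc zero))
  prev (inj₁ (a , suc zero))       = inj₁ (a , zero)
  prev (inj₁ (a , suc (suc zero))) = inj₁ (a , suc zero)
  prev (inj₂ j)                    = inj₂ j

  next-next : ∀ c → next (next c) ≡ prev c
  next-next (inj₁ (_ , zero))           = refl
  next-next (inj₁ (_ , suc zero))       = refl
  next-next (inj₁ (_ , suc (suc zero))) = refl
  next-next (inj₂ _)                    = refl

  R-next : ∀ c → R c (next c)
  R-next (inj₁ (_ , zero))           = refl , tt
  R-next (inj₁ (_ , suc zero))       = refl , tt
  R-next (inj₁ (_ , suc (suc zero))) = refl , tt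
  R-next (inj₂ _)                    = refl

  R-prev : ∀ c → R (prev c) c
  R-prev (inj₁ (_ , zero))           = refl , tt
  R-prev (inj₁ (_ , suc zero))       = refl , tt
  R-prev (inj₁ (_ , suc (suc zero))) = refl , tt
  R-prev (inj₂ _)                    = refl

  R-next-prev : ∀ c → R (next c) (prev c)
  R-next-prev (inj₁ (_ , zero))           = refl , tt
  R-next-prev (inj₁ (_ , suc zero))       = refl , tt
  R-next-prev (inj₁ (_ , suc (suc zero))) = refl , tt
  R-next-prev (inj₂ _)                    = refl

  R⇒≡next : ∀ c d → R c d → c ≢ d → d ≡ next c
  R⇒≡next (inj₁ (_ , zero))           (inj₁ (_ , zero))           (refl , _) c≢d = contradiction refl c≢d
  R⇒≡next (inj₁ (_ , zero))           (inj₁ (_ , suc zero))       (refl , _) _   = refl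
  R⇒≡next (inj₁ (_ , zero))           (inj₁ (_ , suc (suc zero))) (refl , ())
  R⇒≡next (inj₁ (_ , suc zero))       (inj₁ (_ , zero))           (refl , ())
  R⇒≡next (inj₁ (_ , suc zero))       (inj₁ (_ , suc zero))       (refl , _) c≢d = contradiction refl c≢d
  R⇒≡next (inj₁ (_ , suc zero))       (inj₁ (_ , suc (suc zero))) (refl , _) _   = refl
  R⇒≡next (inj₁ (_ , suc (suc zero))) (inj₁ (_ , zero))           (refl , _) _   = refl
  R⇒≡next (inj₁ (_ , suc (suc zero))) (inj₁ (_ , suc zero))       (refl , ())
  R⇒≡next (inj₁ (_ , suc (suc zero))) (inj₁ (_ , suc (suc zero))) (refl , _) c≢d = contradiction refl c≢d
  R⇒≡next (inj₂ _)                    (inj₂ _)                    refl       c≢d = contradiction refl c≢d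

  R-antisym : ∀ c d → R c d → R d c → c ≡ d
  R-antisym c d cd dc with c ≟ d
  ... | yes c≡d = c≡d
  ... | no c≢d with R⇒≡next c d cd c≢d | R⇒≡next d c dc (c≢d ∘ sym)
  R-antisym (inj₁ (_ , zero))           _ _ _ | no _ | refl | ()
  R-antisym (inj₁ (_ , suc zero))       _ _ _ | no _ | refl | ()
  R-antisym (inj₁ (_ , suc (suc zero))) _ _ _ | no _ | refl | ()
  R-antisym (inj₂ _)                    _ _ _ | no c≢d | refl | _ = contradiction refl c≢d

  -- The value at c is the one forced there; otherwise one step after the
  -- forced value at the predecessor, or one step before that at the successor.
  fill : A → Maybe A → Maybe A → Maybe A → A
  fill c _        (just d) _        = d
  fill c (just p) nothing  (just q) with p ≟ q
  ... | yes _ = p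
  ... | no _  = next p
  fill c (just p) nothing  nothing  = next p
  fill c nothing  nothing  (just q) = prev q
  fill c nothing  nothing  nothing  = c

  fill-hom : ∀ c₀ c₁ m₂ m₀ m₁ → R c₀ c₁ →
             WhenDefined R m₀ m₁ → WhenDefined R m₁ m₂ → WhenDefined R m₂ m₀ →
             R (fill c₀ m₂ m₀ m₁) (fill c₁ m₀ m₁ m₂)
  fill-hom _ _ _         (just _)  (just _)  _ r₀₁ _   _ = r₀₁
  fill-hom _ _ (just p₂) (just p₀) nothing   _ _   _   _ with p₀ ≟ p₂
  ... | yes _ = R-refl p₀
  ... | no _  = R-next p₀
  fill-hom _ _ nothing   (just p₀) nothing   _ _   _   _ = R-next p₀
  fill-hom _ _ (just p₂) nothing   (just p₁) _ _   r₁₂ _ with p₂ ≟ p₁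
  ... | yes refl = R-refl p₂
  ... | no p₂≢p₁ rewrite R⇒≡next p₁ p₂ r₁₂ (p₂≢p₁ ∘ sym) | next-next p₁ = R-prev p₁
  fill-hom _ _ nothing   nothing   (just p₁) _ _   _   _ = R-prev p₁
  fill-hom _ _ (just p₂) nothing   nothing   _ _   _   _ = R-next-prev p₂
  fill-hom _ _ nothing   nothing   nothing   r _   _   _ = r

  extends-partial-homs : ExtendsPartialHoms R
  extends-partial-homs h h-hom = G , G-hom , G-extends
    where
    G : A → A
    G (inj₁ (a , i)) = fill (inj₁ (a , i)) (h (prev (inj₁ (a , i)))) (h (inj₁ (a , i))) (h (next (inj₁ (a , i))))
    G (inj₂ j)       = fill (inj₂ j) nothing (h (inj₂ j)) nothing

    step : ∀ c → R (fill c (h (prev c)) (h c) (h (next c))) (fill (next c) (h c) (h (next c)) (h (prev c)))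
    step c = fill-hom c (next c) (h (prev c)) (h c) (h (next c)) (R-next c)
               (h-hom _ _ (R-next c)) (h-hom _ _ (R-next-prev c)) (h-hom _ _ (R-prev c))

    G-next : ∀ c → R (G c) (G (next c))
    G-next c@(inj₁ (_ , zero))           = step c
    G-next c@(inj₁ (_ , suc zero))       = step c
    G-next c@(inj₁ (_ , suc (suc zero))) = step c
    G-next (inj₂ _)                      = R-refl _

    G-hom : ∀ c d → R c d → R (G c) (G d)
    G-hom c d r with c ≟ d
    ... | yes refl = R-refl (G c)
    ... | no c≢d rewrite R⇒≡next c d r c≢d = G-next c

    G-extends : ∀ c d → h c ≡ just d → G c ≡ d
    G-extends (inj₁ _) d hc rewrite hc = refl
    G-extends (inj₂ _) d hc rewrite hc = refl

module Decomposition {n : ℕ} {E : Digraph n} (rf : IsReflexive E) (hh : HomHomogeneous E)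
                     (nbf : NoBackAndForth E) (cross : ¬ ¬ CrossEdge E)
                     {t₀ t₁ t₂ : Fin n} (t₀t₁ : DigraphBasics.OneWay E t₀ t₁)
                     (t₁t₂ : Edge E t₁ t₂) (t₂t₀ : Edge E t₂ t₀) where
  open DigraphBasics E
  open Structure rf hh nbf cross
  open WithTriangle t₀t₁ t₁t₂ t₂t₀

  adj? : ∀ x y → Dec (Adj E x y)
  adj? x y = edge? x y ⊎-dec edge? y x

  open CanonicalRepresentative adj? (inj₁ ∘ rf) Adj-sym Adj-trans

  Directed : Fin n → Set
  Directed x = ∃[ y ] (OneWay x y ⊎ OneWay y x)

  directed? : ∀ x → Dec (Directed x)
  directed? x = any? (λ y → (edge? x y ×-dec ¬? (edge? y x)) ⊎-dec (edge? y x ×-dec ¬? (edge? x y)))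

  Directed-resp-Adj : ∀ {x y} → Adj E x y → Directed x → Directed y
  Directed-resp-Adj xy (z , xz) with adjKind xy | xz
  ... | forward p  | _        = _ , inj₂ p
  ... | backward p | _        = _ , inj₁ p
  ... | both p     | inj₁ o   = z , inj₁ (oneWay-respˡ-⇄ o p)
  ... | both p     | inj₂ o   = z , inj₂ (oneWay-respʳ-⇄ o p)

  undirected-Adj⇒⇄ : ∀ {x y} → ¬ Directed x → Adj E x y → x ⇄ y
  undirected-Adj⇒⇄ ¬dx xy with adjKind xy
  ... | both p     = p
  ... | forward p  = contradiction (_ , inj₁ p) ¬dx
  ... | backward p = contradiction (_ , inj₂ p) ¬dx

  DirectedRoot UndirectedRoot : Fin n → Set
  DirectedRoot x   = canon x ≡ x × Directed x
  UndirectedRoot x = canon x ≡ x × ¬ Directed x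

  module D = Enumeration (enumerate (λ x → (canon x Fin.≟ x) ×-dec directed? x))
  module U = Enumeration (enumerate (λ x → (canon x Fin.≟ x) ×-dec ¬? (directed? x)))

  k l : ℕ
  k = D.size
  l = U.size

  directedRoot : ∀ {x} → Directed x → DirectedRoot (canon x)
  directedRoot {x} d = canon-idem x , Directed-resp-Adj (∼-canon x) d

  undirectedRoot : ∀ {x} → ¬ Directed x → UndirectedRoot (canon x)
  undirectedRoot {x} ¬d = canon-idem x , ¬d ∘ Directed-resp-Adj (Adj-sym (∼-canon x))

  data Position (r x : Fin n) : Fin 3 → Set where
    at-root : r ⇄ x → Position r x zero
    after   : OneWay r x → Position r x (suc zero)
    before  : OneWay x r → Position r x (suc (suc zero))

  position-of : ∀ {r x} → AdjKind r x → ∃ (Position r x)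
  position-of (both p)     = _ , at-root p
  position-of (forward p)  = _ , after p
  position-of (backward p) = _ , before p

  phase : Fin n → Fin 3
  phase x = proj₁ (position-of (adjKind (Adj-sym (∼-canon x))))

  position : ∀ x → Position (canon x) x (phase x)
  position x = proj₂ (position-of (adjKind (Adj-sym (∼-canon x))))

  position-at : ∀ {x r} → canon x ≡ r → Position r x (phase x)
  position-at {x} refl = position x

  position-unique : ∀ {r x i j} → Position r x i → Position r x j → i ≡ j
  position-unique (at-root _)       (at-root _)       = refl
  position-unique (at-root (_ , p)) (after (_ , ¬p))  = contradiction p ¬p
  position-unique (at-root (p , _)) (before (_ , ¬p)) = contradiction p ¬p
  position-unique (after (_ , ¬p))  (at-root (_ , p)) = contradiction p ¬p
  position-unique (after _)         (after _)         = refl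
  position-unique (after (p , _))   (before (_ , ¬p)) = contradiction p ¬p
  position-unique (before (_ , ¬p)) (at-root (p , _)) = contradiction p ¬p
  position-unique (before (_ , ¬p)) (after (p , _))   = contradiction p ¬p
  position-unique (before _)        (before _)        = refl

  position-edge⇒C3∘ : ∀ {r x y i j} → Position r x i → Position r y j → x ⟶ y → C3∘ i j
  position-edge⇒C3∘ (at-root _)       (at-root _)         _  = tt
  position-edge⇒C3∘ (at-root _)       (after _)           _  = tt
  position-edge⇒C3∘ (at-root rx)      (before (_ , ¬ry))  xy = ¬ry (⟶-respˡ-⇄ xy (⇄-sym rx))
  position-edge⇒C3∘ (after (_ , ¬xr)) (at-root ry)        xy = ¬xr (⟶-respʳ-⇄ xy (⇄-sym ry))
  position-edge⇒C3∘ (after _)         (after _)           _  = tt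
  position-edge⇒C3∘ (after _)         (before _)          _  = tt
  position-edge⇒C3∘ (before _)        (at-root _)         _  = tt
  position-edge⇒C3∘ (before xr)       (after ry)          xy =
    proj₂ xr (⟶-respʳ-⇄ (proj₁ ry) (⇄-sym (xy , oneWay-path-closes xr ry)))
  position-edge⇒C3∘ (before _)        (before _)          _  = tt

  C3∘⇒position-edge : ∀ {r x y i j} → Position r x i → Position r y j → C3∘ i j → x ⟶ y
  C3∘⇒position-edge (at-root rx)      (at-root ry)   _ = proj₁ (⇄-trans (⇄-sym rx) ry)
  C3∘⇒position-edge (at-root rx)      (after ry)     _ = ⟶-respˡ-⇄ (proj₁ ry) rx
  C3∘⇒position-edge (after rx)        (after ry)     _ = proj₁ (oneWay-out-⇄ rx ry)
  C3∘⇒position-edge (after rx)        (before yr)    _ = oneWay-path-closes yr rx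
  C3∘⇒position-edge (before (xr , _)) (at-root ry)   _ = ⟶-respʳ-⇄ xr ry
  C3∘⇒position-edge (before xr)       (before yr)    _ = proj₁ (oneWay-in-⇄ xr yr)

  R : KC3L1 k l → KC3L1 k l → Set
  R = kC3+l1 k l

  π : Fin n → KC3L1 k l
  π x with directed? x
  ... | yes d  = inj₁ (D.index (canon x) (directedRoot d) , phase x)
  ... | no ¬d = inj₂ (U.index (canon x) (undirectedRoot ¬d))

  π-directed : ∀ {x} (d : Directed x) → π x ≡ inj₁ (D.index (canon x) (directedRoot d) , phase x)
  π-directed {x} d with directed? x
  ... | yes d′ = cong (λ i → inj₁ (i , phase x)) (D.index-cong refl _ _)
  ... | no ¬d = contradiction d ¬d

  π-undirected : ∀ {x} (¬d : ¬ Directed x) → π x ≡ inj₂ (U.index (canon x) (undirectedRoot ¬d))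
  π-undirected {x} ¬d with directed? x
  ... | yes d   = contradiction d ¬d
  ... | no ¬d′ = cong inj₂ (U.index-cong refl _ _)

  edge⇒R : ∀ {x y} → x ⟶ y → R (π x) (π y)
  edge⇒R {x} {y} xy = by-cases (directed? x)
    where
    same : canon x ≡ canon y
    same = canon-cong (inj₁ xy)

    by-cases : Dec (Directed x) → R (π x) (π y)
    by-cases (yes dx) rewrite π-directed dx | π-directed (Directed-resp-Adj (inj₁ xy) dx) =
      D.index-cong same _ _ , position-edge⇒C3∘ (position x) (position-at (sym same)) xy
    by-cases (no ¬dx) rewrite π-undirected ¬dx | π-undirected (¬dx ∘ Directed-resp-Adj (inj₂ xy)) =
      U.index-cong same _ _

  R⇒edge : ∀ {x y} → R (π x) (π y) → x ⟶ y
  R⇒edge {x} {y} = by-cases (directed? x) (directed? y)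
    where
    by-cases : Dec (Directed x) → Dec (Directed y) → R (π x) (π y) → x ⟶ y
    by-cases (yes dx) (yes dy) rewrite π-directed dx | π-directed dy = λ where
      (same , c) → C3∘⇒position-edge (position x) (position-at (sym (D.index-injective _ _ same))) c
    by-cases (yes dx) (no ¬dy) rewrite π-directed dx | π-undirected ¬dy = λ ()
    by-cases (no ¬dx) (yes dy) rewrite π-undirected ¬dx | π-directed dy = λ ()
    by-cases (no ¬dx) (no ¬dy) rewrite π-undirected ¬dx | π-undirected ¬dy = λ same →
      proj₁ (undirected-Adj⇒⇄ ¬dx (Adj-trans (∼-canon x)
        (subst (λ c → Adj E c y) (sym (U.index-injective _ _ same)) (Adj-sym (∼-canon y)))))

  out-neighbour : ∀ {r} → Directed r → ∃[ y ] OneWay r y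
  out-neighbour (z , inj₁ rz) = z , rz
  out-neighbour (z , inj₂ zr) with complete-triangle zr
  ... | c , rc , cz = c , proj₁ (oneWay-triangle zr rc cz)

  in-neighbour : ∀ {r} → Directed r → ∃[ y ] OneWay y r
  in-neighbour (z , inj₂ zr) = z , zr
  in-neighbour (z , inj₁ rz) with complete-triangle rz
  ... | c , zc , cr = c , proj₂ (oneWay-triangle rz zc cr)

  π-surjective : ∀ a → ∃[ x ] π x ≡ a
  π-surjective (inj₂ j) with U.at-P j
  ... | rr , ¬dr =
    U.at j , trans (π-undirected ¬dr) (cong inj₂ (trans (U.index-cong rr _ (U.at-P j)) (U.index-at j _)))
  π-surjective (inj₁ (i , p)) = realise p
    where
    r : Fin n
    r = D.at i
    rr : canon r ≡ r
    rr = proj₁ (D.at-P i)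
    dr : Directed r
    dr = proj₂ (D.at-P i)

    reach : ∀ {y p} → Adj E r y → Position r y p → ∃[ x ] π x ≡ inj₁ (i , p)
    reach {y} ry pos =
      y , trans (π-directed (Directed-resp-Adj ry dr))
                (cong₂ (λ j q → inj₁ (j , q)) (trans (D.index-cong cy _ (D.at-P i)) (D.index-at i _))
                                              (position-unique (position-at cy) pos))
      where
      cy : canon y ≡ r
      cy = trans (sym (canon-cong ry)) rr

    realise : ∀ p → ∃[ x ] π x ≡ inj₁ (i , p)
    realise zero             = reach (inj₁ (rf r)) (at-root ⇄-refl)
    realise (suc zero) with out-neighbour dr
    ... | _ , ry = reach (inj₁ (proj₁ ry)) (after ry)
    realise (suc (suc zero)) with in-neighbour dr
    ... | _ , yr = reach (inj₂ (proj₁ yr)) (before yr)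

  inflation : IsInflationOf E R
  inflation = inflation-intro {R = R} (Cycles._≟_ k l) (Cycles.R-refl k l) π π-surjective
                (λ x y → mk⇔ edge⇒R R⇒edge)

  k+l≥1 : 1 ≤ k + l
  k+l≥1 = ≤-trans (s≤s z≤n) (≤-trans (toℕ<n (D.index _ (directedRoot (t₁ , inj₁ t₀t₁)))) (m≤m+n k l))


module _ {n : ℕ} {E : Digraph n} where
  open DigraphBasics E

  weakConn⇒¬¬θ : ¬ CrossEdge E → ∀ {x y} → WeakConn E x y → ¬ ¬ θ E x y
  weakConn⇒¬¬θ none ε            = λ ¬θ → ¬θ ε
  weakConn⇒¬¬θ none (xy ◅ rest) = λ ¬θ →
    adj⇒¬¬θ xy (λ θxy → weakConn⇒¬¬θ none rest (λ θyz → ¬θ (θxy ◅◅ θyz)))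
    where
    adj⇒¬¬θ : ∀ {x y} → Adj E x y → ¬ ¬ θ E x y
    adj⇒¬¬θ (inj₁ xy) ¬θ = none (_ , _ , xy , ¬θ)
    adj⇒¬¬θ (inj₂ yx) ¬θ = none (_ , _ , yx , ¬θ ∘ reverse ⇄-sym)

  -- Two of the more numerous θ-classes share a weak component.
  bidirDisconnected⇒crossEdge : BidirDisconnected E → ¬ ¬ CrossEdge E
  bidirDisconnected⇒crossEdge (_ , _ , (weak-rep , _ , weak-cover) , (rep , rep-distinct , _) , w<t) none
    with pigeonhole w<t (proj₁ ∘ weak-cover ∘ rep)
  ... | i , j , i<j , same =
    weakConn⇒¬¬θ none (proj₂ (weak-cover (rep i)) ◅◅ subst (λ c → WeakConn E (weak-rep c) (rep j)) (sym same) (from-rep j))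
      (<⇒≢ i<j ∘ rep-distinct i j)
    where
    from-rep : ∀ j → WeakConn E (weak-rep (proj₁ (weak-cover (rep j)))) (rep j)
    from-rep j = reverse Adj-sym (proj₂ (weak-cover (rep j)))

  transitive-or-gap : IsTransitive E ⊎ ∃[ x ] ∃[ y ] ∃[ z ] (x ⟶ y × y ⟶ z × ¬ (x ⟶ z))
  transitive-or-gap
    with any? (λ x → any? (λ y → any? (λ z → edge? x y ×-dec (edge? y z ×-dec ¬? (edge? x z)))))
  ... | yes gap  = inj₂ gap
  ... | no ¬gap = inj₁ λ x y z xy yz → decidable-stable (edge? x z) (λ ¬xz → ¬gap (x , y , z , xy , yz , ¬xz))

  gap⇒inflation : IsReflexive E → HomHomogeneous E → NoBackAndForth E → ¬ ¬ CrossEdge E →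
                  ∃[ x ] ∃[ y ] ∃[ z ] (x ⟶ y × y ⟶ z × ¬ (x ⟶ z)) →
                  ∃[ k ] ∃[ l ] (1 ≤ k + l × IsInflationOf E (kC3+l1 k l))
  gap⇒inflation rf hh nbf cross (_ , _ , _ , xy , yz , ¬xz)
    with Structure.¬transitive⇒triangle rf hh nbf cross xy yz ¬xz
  ... | _ , _ , _ , t₀t₁ , t₁t₂ , t₂t₀ = k , l , k+l≥1 , inflation
    where open Decomposition rf hh nbf cross t₀t₁ t₁t₂ t₂t₀

  cycles-inflation⇒homHomogeneous : ∀ k l → IsInflationOf E (kC3+l1 k l) → HomHomogeneous E
  cycles-inflation⇒homHomogeneous k l =
    inflation-homHomogeneous (Cycles._≟_ k l) (Cycles.R-refl k l) (Cycles.R-antisym k l)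
                             (Cycles.extends-partial-homs k l)

theorem5p6 : (n : ℕ) (E : Digraph n) →
    IsReflexive E → BidirDisconnected E → Improper E → NoBackAndForth E →
    (HomHomogeneous E ⇔
      ((IsQuasiorder E × HomHomogeneous E)
       ⊎ (∃[ k ] ∃[ l ] (1 ≤ k + l × IsInflationOf E (kC3+l1 k l)))))
theorem5p6 n E rf disconnected _ nbf = mk⇔ forward backward
  where
  InflatesCycles : Set
  InflatesCycles = ∃[ k ] ∃[ l ] (1 ≤ k + l × IsInflationOf E (kC3+l1 k l))

  forward : HomHomogeneous E → (IsQuasiorder E × HomHomogeneous E) ⊎ InflatesCycles
  forward hh with transitive-or-gap
  ... | inj₁ transitive = inj₁ ((rf , transitive) , hh)
  ... | inj₂ gap = inj₂ (gap⇒inflation rf hh nbf (bidirDisconnected⇒crossEdge disconnected) gap)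

  backward : (IsQuasiorder E × HomHomogeneous E) ⊎ InflatesCycles → HomHomogeneous E
  backward (inj₁ (_ , hh))           = hh
  backward (inj₂ (k , l , _ , infl)) = cycles-inflation⇒homHomogeneous k l infl
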